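{- For every composition $F$ of $I$, the function $\mathtt{p}_F$ on trees over $I$ respects antisymmetry and the Jacobi identity, hence defines an element $\mathtt{p}_F\in\mathbf{Zie}^*[I]=\mathrm{Hom}(\mathbf{Zie}[I],\mathbb{k})$.
   Context: Let $\mathbb{k}$ be a field of characteristic zero and $I$ a nonempty finite set. A tree over $I$ is a planar full binary tree whose leaves are labeled bijectively by the blocks of a set partition of $I$ (its lumps); listing the lumps from left to right gives a composition $F_{\mathcal T}$ of $I$, the debracketing of $\mathcal T$. $\mathbf{Zie}[I]$ is the $\mathbb{k}$-span of trees over $I$ modulo antisymmetry $[A,B]=-[B,A]$ and the Jacobi identity at any node. For a tree $\mathcal T$, $\mathrm{antisym}(\mathcal T)$ is the set of $2^{l(F_{\mathcal T})-1}$ trees obtained by switching left and right branches at nodes of $\mathcal T$, and for $\mathcal T'\in\mathrm{antisym}(\mathcal T)$, $(\mathcal T,\mathcal T')\in\mathbb{Z}/2$ is the parity of the number of node switches taking $\mathcal T$ to $\mathcal T'$. For a composition $F$ of $I$ let $\boldsymbol{\mathcal T}(F)=\bigsqcup_{\mathcal T:\,F_{\mathcal T}=F}\mathrm{antisym}(\mathcal T)$ (a disjoint union). Define $\mathtt{p}_F(\mathcal T'):=(-1)^{(\mathcal T,\mathcal T')}$ if $\mathcal T'\in\mathrm{antisym}(\mathcal T)$ with $F_{\mathcal T}=F$, and $\mathtt{p}_F(\mathcal T'):=0$ if $\mathcal T'\notin\boldsymbol{\mathcal T}(F)$. -}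

module Defs where

open import Data.Nat using (ℕ; zero; suc)
open import Data.Bool using (Bool; if_then_else_)
import Data.Bool.Properties as BoolP
open import Data.Integer using (ℤ; +_; -_; _*_; _+_)
open import Data.Fin.Subset using (Subset; Nonempty; Empty; _∩_; ⋃; ⊤)
open import Data.Vec.Properties using (≡-dec)
open import Data.List using (List; []; _∷_; [_]; map; concatMap; length)
import Data.List as L
open import Data.List.Relation.Unary.All using (All)
open import Data.List.Relation.Unary.AllPairs using (AllPairs)
open import Data.Product using (_×_; _,_)
open import Relation.Binary.PropositionalEquality using (_≡_; refl; cong₂)
open import Relation.Nullary using (Dec; yes; no; does)
open import Relation.Binary.Definitions using (DecidableEquality)

-- The finite set I is taken to be Fin n (n ≥ 1); a subset of I is a
-- 'Subset n'.

IsComposition : ∀ {n} → List (Subset n) → Set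
IsComposition F =
  All Nonempty F × AllPairs (λ S T → Empty (S ∩ T)) F × (⋃ F ≡ ⊤)

data Tree (n : ℕ) : Set where
  leaf : Subset n → Tree n
  node : Tree n → Tree n → Tree n

debracket : ∀ {n} → Tree n → List (Subset n)
debracket (leaf S)   = [ S ]
debracket (node A B) = debracket A L.++ debracket B

-- A tree over I: its lumps form a set partition of I (and thus its
-- debracketing is a composition of I, lumps being listed bijectively).
IsTreeOver : ∀ {n} → Tree n → Set
IsTreeOver T = IsComposition (debracket T)

_≟T_ : ∀ {n} → DecidableEquality (Tree n)
leaf S ≟T leaf S' with ≡-dec BoolP._≟_ S S'
... | yes refl = yes refl
... | no ne = no λ { refl → ne refl }
leaf _ ≟T node _ _ = no λ ()
node _ _ ≟T leaf _ = no λ ()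
node A B ≟T node A' B' with A ≟T A' | B ≟T B'
... | yes refl | yes refl = yes refl
... | no ne | _ = no λ { refl → ne refl }
... | yes _ | no ne = no λ { refl → ne refl }

-- antisym(T): all trees obtained from T by switching left and right
-- branches at some set of nodes, each paired with the sign
-- (-1)^(T,T') of the parity of the number of switches.
antisym : ∀ {n} → Tree n → List (Tree n × ℤ)
antisym (leaf S)   = [ (leaf S , + 1) ]
antisym (node A B) =
  concatMap (λ { (a , s) → concatMap (λ { (b , t) →
      (node a b , s * t) ∷ (node b a , - (s * t)) ∷ [] }) (antisym B) })
    (antisym A)

splits : ∀ {A : Set} → List A → List (List A × List A)
splits []           = []
splits (x ∷ [])     = []
splits (x ∷ y ∷ zs) =
  ([ x ] , y ∷ zs) ∷ map (λ { (l , r) → (x ∷ l , r) }) (splits (y ∷ zs))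

-- All trees with a given debracketing (fuel = length of the list).
bracketingsFuel : ∀ {n} → ℕ → List (Subset n) → List (Tree n)
bracketingsFuel _ []           = []
bracketingsFuel _ (x ∷ [])     = [ leaf x ]
bracketingsFuel zero (_ ∷ _ ∷ _) = []
bracketingsFuel (suc k) xs@(_ ∷ _ ∷ _) =
  concatMap (λ { (l , r) → concatMap (λ a → map (node a) (bracketingsFuel k r))
                                     (bracketingsFuel k l) })
    (splits xs)

bracketings : ∀ {n} → List (Subset n) → List (Tree n)
bracketings F = bracketingsFuel (length F) F

sumℤ : List ℤ → ℤ
sumℤ = L.foldr _+_ (+ 0)

-- p_F(T') = (-1)^(T,T') if T' ∈ antisym(T) with F_T = F, and 0 if
-- T' ∉ 𝒯(F).  Since 𝒯(F) is a disjoint union (for trees over I), this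
-- equals the following sum over all T with F_T = F and all T'' ∈ antisym(T).
p : ∀ {n} → List (Subset n) → Tree n → ℤ
p F T' =
  sumℤ (map (λ T → sumℤ (map (λ { (T'' , s) → if does (T'' ≟T T') then s else + 0 })
                              (antisym T)))
             (bracketings F))

-- One-hole contexts, to express relations at an arbitrary node.
data Ctx (n : ℕ) : Set where
  hole : Ctx n
  inL  : Ctx n → Tree n → Ctx n
  inR  : Tree n → Ctx n → Ctx n

plug : ∀ {n} → Ctx n → Tree n → Tree n
plug hole      X = X
plug (inL C B) X = node (plug C X) B
plug (inR A C) X = node A (plug C X)

module Submission where

-- View F ↦ p_F(T) as a function  pOf T : List (Subset n) → ℤ  on lists of lumps,
-- and equip such functions with the convolution product
--   (f ⋆ g)(F) = Σ_{F = l ++ r, l, r ≠ []} f(l) · g(r)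
-- and its commutator  ⟦ f , g ⟧ = f ⋆ g − g ⋆ f.  The proof has three parts.
--   1. Convolution is bilinear and associative (induction on F, peeling off
--      the first lump), so ⟦_,_⟧ is antisymmetric and satisfies the Jacobi
--      identity, as the commutator of any associative product does.
--   2. The key combinatorial fact: pOf (node U V) = ⟦ pOf U , pOf V ⟧.  A
--      bracketing of F with root split F = l ++ r is a node over bracketings
--      of l and r, and the signed multiplicity of node U V in antisym(node a b)
--      is  w(a,U)·w(b,V) − w(a,V)·w(b,U).
--   3. By bilinearity of ⟦_,_⟧, a formal sum of trees killed by every p_G stays
--      killed after being plugged into a context; combined with 1 and 2 this
--      gives both relations at an arbitrary node.

open import Defs
open import Data.Nat using (ℕ; suc)
open import Data.Integer using (ℤ; _+_; +_)
open import Data.Fin.Subset using (Subset)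
open import Data.List using (List)
open import Data.Product using (_×_)
open import Relation.Binary.PropositionalEquality using (_≡_)

import Data.Nat as ℕ
import Data.Nat.Properties as ℕP
open import Data.Integer using (_*_; _-_; -_)
import Data.Integer.Properties as ℤP
open import Data.Integer.Tactic.RingSolver using (solve-∀)
open import Data.Bool using (true; false; if_then_else_)
open import Data.List using ([]; _∷_; [_]; map; concat; concatMap; length; _++_)
open import Data.List.Relation.Unary.All as All using (All; []; _∷_)
import Data.List.Relation.Unary.All.Properties as AllP
open import Data.List.Properties using (map-cong; map-cong-local)
open import Data.Product using (_,_; proj₁; proj₂)
open import Relation.Binary.PropositionalEquality
  using (refl; cong; cong₂; sym; trans; _≗_; module ≡-Reasoning)
open import Relation.Nullary using (yes; no; does)

∑ : {A : Set} → List A → (A → ℤ) → ℤ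
∑ xs φ = sumℤ (map φ xs)

module _ {A : Set} where

  ∑-cong : (xs : List A) {φ ψ : A → ℤ} → φ ≗ ψ → ∑ xs φ ≡ ∑ xs ψ
  ∑-cong []       e = refl
  ∑-cong (x ∷ xs) e = cong₂ _+_ (e x) (∑-cong xs e)

  ∑-congAll : {xs : List A} {φ ψ : A → ℤ} → All (λ x → φ x ≡ ψ x) xs → ∑ xs φ ≡ ∑ xs ψ
  ∑-congAll es = cong sumℤ (map-cong-local es)

  ∑-pair : (x y : A) (φ : A → ℤ) → ∑ (x ∷ y ∷ []) φ ≡ φ x + φ y
  ∑-pair x y φ = cong (_+_ (φ x)) (ℤP.+-identityʳ (φ y))

  ∑-triple : (x y z : A) (φ : A → ℤ) → ∑ (x ∷ y ∷ z ∷ []) φ ≡ φ x + φ y + φ z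
  ∑-triple x y z φ = trans (cong (_+_ (φ x)) (∑-pair y z φ)) (sym (ℤP.+-assoc (φ x) (φ y) (φ z)))

  ∑-zero : (xs : List A) {φ : A → ℤ} → (∀ x → φ x ≡ + 0) → ∑ xs φ ≡ + 0
  ∑-zero []       e = refl
  ∑-zero (x ∷ xs) e = cong₂ _+_ (e x) (∑-zero xs e)

  ∑-+ : (xs : List A) (φ ψ : A → ℤ) → ∑ xs (λ x → φ x + ψ x) ≡ ∑ xs φ + ∑ xs ψ
  ∑-+ []       φ ψ = refl
  ∑-+ (x ∷ xs) φ ψ =
    trans (cong (_+_ (φ x + ψ x)) (∑-+ xs φ ψ)) (interchange (φ x) (ψ x) (∑ xs φ) (∑ xs ψ))
    where
    interchange : ∀ a b c d → (a + b) + (c + d) ≡ (a + c) + (b + d)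
    interchange = solve-∀

  ∑-- : (xs : List A) (φ ψ : A → ℤ) → ∑ xs (λ x → φ x - ψ x) ≡ ∑ xs φ - ∑ xs ψ
  ∑-- xs φ ψ = trans (∑-+ xs φ (λ x → - ψ x)) (cong (_+_ (∑ xs φ)) (∑-neg xs))
    where
    ∑-neg : (ys : List A) → ∑ ys (λ x → - ψ x) ≡ - ∑ ys ψ
    ∑-neg []       = refl
    ∑-neg (y ∷ ys) = trans (cong (_+_ (- ψ y)) (∑-neg ys)) (sym (ℤP.neg-distrib-+ (ψ y) (∑ ys ψ)))

  ∑-*ˡ : (xs : List A) (c : ℤ) (φ : A → ℤ) → ∑ xs (λ x → c * φ x) ≡ c * ∑ xs φ
  ∑-*ˡ []       c φ = sym (ℤP.*-zeroʳ c)
  ∑-*ˡ (x ∷ xs) c φ =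
    trans (cong (_+_ (c * φ x)) (∑-*ˡ xs c φ)) (sym (ℤP.*-distribˡ-+ c (φ x) (∑ xs φ)))

  ∑-*ʳ : (xs : List A) (c : ℤ) (φ : A → ℤ) → ∑ xs (λ x → φ x * c) ≡ ∑ xs φ * c
  ∑-*ʳ xs c φ = begin
    ∑ xs (λ x → φ x * c)  ≡⟨ ∑-cong xs (λ x → ℤP.*-comm (φ x) c) ⟩
    ∑ xs (λ x → c * φ x)  ≡⟨ ∑-*ˡ xs c φ ⟩
    c * ∑ xs φ            ≡⟨ ℤP.*-comm c (∑ xs φ) ⟩
    ∑ xs φ * c            ∎
    where open ≡-Reasoning

  ∑-++ : (xs ys : List A) (φ : A → ℤ) → ∑ (xs ++ ys) φ ≡ ∑ xs φ + ∑ ys φ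
  ∑-++ []       ys φ = sym (ℤP.+-identityˡ _)
  ∑-++ (x ∷ xs) ys φ = trans (cong (_+_ (φ x)) (∑-++ xs ys φ)) (sym (ℤP.+-assoc (φ x) _ _))

  ∑-concat : (xss : List (List A)) (φ : A → ℤ) → ∑ (concat xss) φ ≡ ∑ xss (λ xs → ∑ xs φ)
  ∑-concat []         φ = refl
  ∑-concat (xs ∷ xss) φ = trans (∑-++ xs (concat xss) φ) (cong (_+_ (∑ xs φ)) (∑-concat xss φ))

∑-map : {A B : Set} (xs : List A) (h : A → B) (φ : B → ℤ) → ∑ (map h xs) φ ≡ ∑ xs (λ x → φ (h x))
∑-map []       h φ = refl
∑-map (x ∷ xs) h φ = cong (_+_ (φ (h x))) (∑-map xs h φ)

module _ {A B : Set} where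

  ∑-concatMap : (xs : List A) (k : A → List B) (φ : B → ℤ) →
    ∑ (concatMap k xs) φ ≡ ∑ xs (λ x → ∑ (k x) φ)
  ∑-concatMap xs k φ = trans (∑-concat (map k xs) φ) (∑-map xs k (λ ys → ∑ ys φ))

  ∑-swap : (xs : List A) (ys : List B) (φ : A → B → ℤ) →
    ∑ xs (λ x → ∑ ys (φ x)) ≡ ∑ ys (λ y → ∑ xs (λ x → φ x y))
  ∑-swap []       ys φ = sym (∑-zero ys (λ _ → refl))
  ∑-swap (x ∷ xs) ys φ =
    trans (cong (_+_ (∑ ys (φ x))) (∑-swap xs ys φ)) (sym (∑-+ ys (φ x) (λ y → ∑ xs (λ x' → φ x' y))))

  ∑-∑-antisym : (xs : List A) (ys : List B) (f h : A → ℤ) (g k : B → ℤ) →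
    ∑ xs (λ a → ∑ ys (λ b → f a * g b - h a * k b)) ≡ ∑ xs f * ∑ ys g - ∑ xs h * ∑ ys k
  ∑-∑-antisym xs ys f h g k = begin
    ∑ xs (λ a → ∑ ys (λ b → f a * g b - h a * k b))
      ≡⟨ ∑-cong xs (λ a → ∑-- ys (λ b → f a * g b) (λ b → h a * k b)) ⟩
    ∑ xs (λ a → ∑ ys (λ b → f a * g b) - ∑ ys (λ b → h a * k b))
      ≡⟨ ∑-- xs _ _ ⟩
    ∑ xs (λ a → ∑ ys (λ b → f a * g b)) - ∑ xs (λ a → ∑ ys (λ b → h a * k b))
      ≡⟨ cong₂ _-_ (product f g) (product h k) ⟩
    ∑ xs f * ∑ ys g - ∑ xs h * ∑ ys k ∎
    where
    open ≡-Reasoning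
    product : (f : A → ℤ) (g : B → ℤ) → ∑ xs (λ a → ∑ ys (λ b → f a * g b)) ≡ ∑ xs f * ∑ ys g
    product f g = trans (∑-cong xs (λ a → ∑-*ˡ ys (f a) g)) (∑-*ʳ xs (∑ ys g) f)

module Convolution {A : Set} where

  _⋆_ : (List A → ℤ) → (List A → ℤ) → List A → ℤ
  (f ⋆ g) F = ∑ (splits F) (λ lr → f (proj₁ lr) * g (proj₂ lr))

  infixl 7 _⋆_

  ⟦_,_⟧ : (List A → ℤ) → (List A → ℤ) → List A → ℤ
  ⟦ f , g ⟧ F = (f ⋆ g) F - (g ⋆ f) F

  ⋆-cong : {f f' g g' : List A → ℤ} → f ≗ f' → g ≗ g' → f ⋆ g ≗ f' ⋆ g'
  ⋆-cong ef eg F = ∑-cong (splits F) (λ lr → cong₂ _*_ (ef (proj₁ lr)) (eg (proj₂ lr)))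

  -- Peeling off the first element: either it forms the whole left part, or
  -- it is prepended to the left part of a splitting of the rest.
  ⋆-cons : (f g : List A → ℤ) (x y : A) (zs : List A) →
    (f ⋆ g) (x ∷ y ∷ zs) ≡ f [ x ] * g (y ∷ zs) + ((λ l → f (x ∷ l)) ⋆ g) (y ∷ zs)
  ⋆-cons f g x y zs = cong (_+_ (f [ x ] * g (y ∷ zs)))
    (trans (∑-map (splits (y ∷ zs)) _ _) (∑-cong (splits (y ∷ zs)) (λ { (l , r) → refl })))

  -- Left parts of splittings are nonempty, so only the values of f on
  -- nonempty lists matter.
  ⋆-cong-nonempty : (f f' g : List A → ℤ) →
    (∀ a l → f (a ∷ l) ≡ f' (a ∷ l)) → f ⋆ g ≗ f' ⋆ g
  ⋆-cong-nonempty f f' g e []           = refl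
  ⋆-cong-nonempty f f' g e (x ∷ [])     = refl
  ⋆-cong-nonempty f f' g e (x ∷ y ∷ zs) = begin
    (f ⋆ g) (x ∷ y ∷ zs)                                     ≡⟨ ⋆-cons f g x y zs ⟩
    f [ x ] * g (y ∷ zs) + ((λ l → f (x ∷ l)) ⋆ g) (y ∷ zs)
      ≡⟨ cong₂ (λ u v → u * g (y ∷ zs) + v) (e x [])
               (⋆-cong-nonempty (λ l → f (x ∷ l)) (λ l → f' (x ∷ l)) g (λ a l → e x (a ∷ l)) (y ∷ zs)) ⟩
    f' [ x ] * g (y ∷ zs) + ((λ l → f' (x ∷ l)) ⋆ g) (y ∷ zs) ≡⟨ sym (⋆-cons f' g x y zs) ⟩
    (f' ⋆ g) (x ∷ y ∷ zs)                                    ∎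
    where open ≡-Reasoning

  ⋆-+ˡ : (f f' g : List A → ℤ) (F : List A) → ((λ l → f l + f' l) ⋆ g) F ≡ (f ⋆ g) F + (f' ⋆ g) F
  ⋆-+ˡ f f' g F = trans (∑-cong (splits F) (λ lr → ℤP.*-distribʳ-+ (g (proj₂ lr)) (f (proj₁ lr)) _))
                        (∑-+ (splits F) _ _)

  ⋆-*ˡ : (c : ℤ) (f g : List A → ℤ) (F : List A) → ((λ l → c * f l) ⋆ g) F ≡ c * (f ⋆ g) F
  ⋆-*ˡ c f g F = trans (∑-cong (splits F) (λ lr → ℤP.*-assoc c (f (proj₁ lr)) (g (proj₂ lr))))
                       (∑-*ˡ (splits F) c _)

  ⋆--ˡ : (f f' g : List A → ℤ) (F : List A) → ((λ l → f l - f' l) ⋆ g) F ≡ (f ⋆ g) F - (f' ⋆ g) F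
  ⋆--ˡ f f' g F = trans (∑-cong (splits F) (λ lr → distrib (f (proj₁ lr)) (f' (proj₁ lr)) (g (proj₂ lr))))
                        (∑-- (splits F) _ _)
    where
    distrib : ∀ a b c → (a - b) * c ≡ a * c - b * c
    distrib = solve-∀

  ⋆--ʳ : (f g g' : List A → ℤ) (F : List A) → (f ⋆ (λ l → g l - g' l)) F ≡ (f ⋆ g) F - (f ⋆ g') F
  ⋆--ʳ f g g' F = trans (∑-cong (splits F) (λ lr → distrib (f (proj₁ lr)) (g (proj₂ lr)) (g' (proj₂ lr))))
                        (∑-- (splits F) _ _)
    where
    distrib : ∀ a b c → a * (b - c) ≡ a * b - a * c
    distrib = solve-∀

  ∑-⋆ˡ : {I : Set} (is : List I) (f : I → List A → ℤ) (g : List A → ℤ) (F : List A) →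
    ∑ is (λ i → (f i ⋆ g) F) ≡ ((λ H → ∑ is (λ i → f i H)) ⋆ g) F
  ∑-⋆ˡ is f g F = trans (∑-swap is (splits F) _)
    (∑-cong (splits F) (λ lr → ∑-*ʳ is (g (proj₂ lr)) (λ i → f i (proj₁ lr))))

  ∑-⋆ʳ : {I : Set} (is : List I) (f : List A → ℤ) (g : I → List A → ℤ) (F : List A) →
    ∑ is (λ i → (f ⋆ g i) F) ≡ (f ⋆ (λ H → ∑ is (λ i → g i H))) F
  ∑-⋆ʳ is f g F = trans (∑-swap is (splits F) _)
    (∑-cong (splits F) (λ lr → ∑-*ˡ is (f (proj₁ lr)) (λ i → g i (proj₂ lr))))

  ⋆-zeroˡ : (f g : List A → ℤ) → (∀ H → f H ≡ + 0) → ∀ F → (f ⋆ g) F ≡ + 0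
  ⋆-zeroˡ f g e F =
    ∑-zero (splits F) (λ lr → trans (cong (_* g (proj₂ lr)) (e (proj₁ lr))) (ℤP.*-zeroˡ (g (proj₂ lr))))

  ⋆-zeroʳ : (f g : List A → ℤ) → (∀ H → g H ≡ + 0) → ∀ F → (f ⋆ g) F ≡ + 0
  ⋆-zeroʳ f g e F =
    ∑-zero (splits F) (λ lr → trans (cong (f (proj₁ lr) *_) (e (proj₂ lr))) (ℤP.*-zeroʳ (f (proj₁ lr))))

  -- Associativity, by induction on F generalising over f: both sides peel
  -- off f [ x ] times the rest, and the remaining terms agree by induction
  -- applied to λ l → f (x ∷ l).
  ⋆-assoc : (f g h : List A → ℤ) (F : List A) → ((f ⋆ g) ⋆ h) F ≡ (f ⋆ (g ⋆ h)) F
  ⋆-assoc f g h []           = refl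
  ⋆-assoc f g h (x ∷ [])     = refl
  ⋆-assoc f g h (x ∷ y ∷ zs) = begin
    ((f ⋆ g) ⋆ h) (x ∷ ys)
      ≡⟨ ⋆-cons (f ⋆ g) h x y zs ⟩
    + 0 * h ys + ((λ l → (f ⋆ g) (x ∷ l)) ⋆ h) ys
      ≡⟨ ℤP.+-identityˡ _ ⟩
    ((λ l → (f ⋆ g) (x ∷ l)) ⋆ h) ys
      ≡⟨ ⋆-cong-nonempty (λ l → (f ⋆ g) (x ∷ l)) (λ l → f [ x ] * g l + (f⁺ ⋆ g) l)
                         h (λ a l → ⋆-cons f g x a l) ys ⟩
    ((λ l → f [ x ] * g l + (f⁺ ⋆ g) l) ⋆ h) ys
      ≡⟨ ⋆-+ˡ (λ l → f [ x ] * g l) (f⁺ ⋆ g) h ys ⟩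
    ((λ l → f [ x ] * g l) ⋆ h) ys + ((f⁺ ⋆ g) ⋆ h) ys
      ≡⟨ cong₂ _+_ (⋆-*ˡ (f [ x ]) g h ys) (⋆-assoc f⁺ g h (y ∷ zs)) ⟩
    f [ x ] * (g ⋆ h) ys + (f⁺ ⋆ (g ⋆ h)) ys
      ≡⟨ sym (⋆-cons f (g ⋆ h) x y zs) ⟩
    (f ⋆ (g ⋆ h)) (x ∷ ys) ∎
    where
    open ≡-Reasoning
    ys = y ∷ zs
    f⁺ = λ l → f (x ∷ l)

  ⟦⟧-cong : {f f' g g' : List A → ℤ} → f ≗ f' → g ≗ g' → ⟦ f , g ⟧ ≗ ⟦ f' , g' ⟧
  ⟦⟧-cong ef eg F = cong₂ _-_ (⋆-cong ef eg F) (⋆-cong eg ef F)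

  ⟦⟧-antisym : (f g : List A → ℤ) (F : List A) → ⟦ f , g ⟧ F + ⟦ g , f ⟧ F ≡ + 0
  ⟦⟧-antisym f g F = cancel ((f ⋆ g) F) ((g ⋆ f) F)
    where
    cancel : ∀ a b → (a - b) + (b - a) ≡ + 0
    cancel = solve-∀

  ⟦⟧-jacobi : (a b d : List A → ℤ) (F : List A) →
    ⟦ ⟦ a , b ⟧ , d ⟧ F + ⟦ ⟦ b , d ⟧ , a ⟧ F + ⟦ ⟦ d , a ⟧ , b ⟧ F ≡ + 0
  ⟦⟧-jacobi a b d F =
    trans (cong₂ _+_ (cong₂ _+_ (expand a b d) (expand b d a)) (expand d a b))
          (cancel (t a b d) (t b a d) (t d a b) (t d b a) (t b d a) (t a d b))
    where
    t : (List A → ℤ) → (List A → ℤ) → (List A → ℤ) → ℤ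
    t u v w = (u ⋆ (v ⋆ w)) F
    expand : ∀ u v w → ⟦ ⟦ u , v ⟧ , w ⟧ F ≡ (t u v w - t v u w) - (t w u v - t w v u)
    expand u v w = cong₂ _-_
      (trans (⋆--ˡ (u ⋆ v) (v ⋆ u) w F) (cong₂ _-_ (⋆-assoc u v w F) (⋆-assoc v u w F)))
      (⋆--ʳ w (u ⋆ v) (v ⋆ u) F)
    cancel : ∀ p₁ p₂ p₃ p₄ p₅ p₆ →
      (p₁ - p₂ - (p₃ - p₄)) + (p₅ - p₄ - (p₁ - p₆)) + (p₃ - p₆ - (p₅ - p₂)) ≡ + 0
    cancel = solve-∀

  ⟦⟧-killsˡ : {I : Set} (is : List I) (f : I → List A → ℤ) (g : List A → ℤ) →
    (∀ H → ∑ is (λ i → f i H) ≡ + 0) → ∀ F → ∑ is (λ i → ⟦ f i , g ⟧ F) ≡ + 0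
  ⟦⟧-killsˡ is f g z F = begin
    ∑ is (λ i → ⟦ f i , g ⟧ F)
      ≡⟨ ∑-- is (λ i → (f i ⋆ g) F) (λ i → (g ⋆ f i) F) ⟩
    ∑ is (λ i → (f i ⋆ g) F) - ∑ is (λ i → (g ⋆ f i) F)
      ≡⟨ cong₂ _-_ (trans (∑-⋆ˡ is f g F) (⋆-zeroˡ _ g z F)) (trans (∑-⋆ʳ is g f F) (⋆-zeroʳ g _ z F)) ⟩
    + 0 ∎
    where open ≡-Reasoning

  ⟦⟧-killsʳ : {I : Set} (is : List I) (g : List A → ℤ) (f : I → List A → ℤ) →
    (∀ H → ∑ is (λ i → f i H) ≡ + 0) → ∀ F → ∑ is (λ i → ⟦ g , f i ⟧ F) ≡ + 0
  ⟦⟧-killsʳ is g f z F = begin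
    ∑ is (λ i → ⟦ g , f i ⟧ F)
      ≡⟨ ∑-- is (λ i → (g ⋆ f i) F) (λ i → (f i ⋆ g) F) ⟩
    ∑ is (λ i → (g ⋆ f i) F) - ∑ is (λ i → (f i ⋆ g) F)
      ≡⟨ cong₂ _-_ (trans (∑-⋆ʳ is g f F) (⋆-zeroʳ g _ z F)) (trans (∑-⋆ˡ is f g F) (⋆-zeroˡ _ g z F)) ⟩
    + 0 ∎
    where open ≡-Reasoning

open Convolution

pOf : ∀ {n} → Tree n → List (Subset n) → ℤ
pOf T F = p F T

δ : ∀ {n} → Tree n → Tree n → ℤ
δ T T' = if does (T ≟T T') then + 1 else + 0

δ-node : ∀ {n} (a b U V : Tree n) → δ (node a b) (node U V) ≡ δ a U * δ b V
δ-node a b U V with a ≟T U | b ≟T V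
... | yes refl | yes refl = refl
... | yes refl | no _     = refl
... | no _     | _        = sym (ℤP.*-zeroˡ (δ b V))

weight : ∀ {n} → Tree n → Tree n → ℤ
weight T T' = ∑ (antisym T) (λ Ts → proj₂ Ts * δ (proj₁ Ts) T')

p-weights : ∀ {n} (F : List (Subset n)) (T' : Tree n) →
  p F T' ≡ ∑ (bracketings F) (λ T → weight T T')
p-weights F T' = ∑-cong (bracketings F) (λ T → ∑-cong (antisym T) (λ { (T'' , s) → indicator T'' s }))
  where
  indicator : ∀ T'' s → (if does (T'' ≟T T') then s else + 0) ≡ s * δ T'' T'
  indicator T'' s with does (T'' ≟T T')
  ... | true  = sym (ℤP.*-identityʳ s)
  ... | false = sym (ℤP.*-zeroʳ s)

-- antisym(node X Y) pairs each (a , s) ∈ antisym X and (b , t) ∈ antisym Y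
-- into (node a b , st) and (node b a , −st); so multiplicities of a node
-- factor as an antisymmetrised product.
weight-node : ∀ {n} (X Y U V : Tree n) →
  weight (node X Y) (node U V) ≡ weight X U * weight Y V - weight X V * weight Y U
weight-node X Y U V =
  trans (∑-concatMap (antisym X) _ _)
  (trans (∑-cong (antisym X) (λ { (a , s) →
            trans (∑-concatMap (antisym Y) _ _)
                  (∑-cong (antisym Y) (λ { (b , t) → both-orders a s b t })) }))
         (∑-∑-antisym (antisym X) (antisym Y) (mult U) (mult V) (mult V) (mult U)))
  where
  mult : Tree _ → Tree _ × ℤ → ℤ
  mult W Ts = proj₂ Ts * δ (proj₁ Ts) W
  both-orders : ∀ a s b t →
    s * t * δ (node a b) (node U V) + (- (s * t) * δ (node b a) (node U V) + + 0)
      ≡ s * δ a U * (t * δ b V) - s * δ a V * (t * δ b U)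
  both-orders a s b t rewrite δ-node a b U V | δ-node b a U V = ring s t (δ a U) (δ b V) (δ b U) (δ a V)
    where
    ring : ∀ s t aU bV bU aV → s * t * (aU * bV) + (- (s * t) * (bU * aV) + + 0)
                                  ≡ s * aU * (t * bV) - s * aV * (t * bU)
    ring = solve-∀

weight-nodes : ∀ {n} (Ls Rs : List (Tree n)) (U V : Tree n) →
  ∑ (concatMap (λ a → map (node a) Rs) Ls) (λ T → weight T (node U V))
    ≡ ∑ Ls (λ a → weight a U) * ∑ Rs (λ b → weight b V) - ∑ Ls (λ a → weight a V) * ∑ Rs (λ b → weight b U)
weight-nodes Ls Rs U V =
  trans (∑-concatMap Ls _ _)
  (trans (∑-cong Ls (λ a → trans (∑-map Rs (node a) _) (∑-cong Rs (λ b → weight-node a b U V))))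
         (∑-∑-antisym Ls Rs _ _ _ _))

splits-shorter : {A : Set} (xs : List A) →
  All (λ lr → length (proj₁ lr) ℕ.< length xs × length (proj₂ lr) ℕ.< length xs) (splits xs)
splits-shorter []           = []
splits-shorter (x ∷ [])     = []
splits-shorter (x ∷ y ∷ zs) =
  (ℕ.s≤s (ℕ.s≤s ℕ.z≤n) , ℕP.≤-refl) ∷
  AllP.map⁺ (All.map (λ { {l , r} (l< , r<) → ℕ.s≤s l< , ℕP.m≤n⇒m≤1+n r< }) (splits-shorter (y ∷ zs)))

fuel-irrelevant : ∀ {n} (k m : ℕ) (F : List (Subset n)) →
  length F ℕ.≤ k → length F ℕ.≤ m → bracketingsFuel k F ≡ bracketingsFuel m F
fuel-irrelevant k       m       []           _ _ = refl
fuel-irrelevant k       m       (x ∷ [])     _ _ = refl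
fuel-irrelevant (suc k) (suc m) F@(x ∷ y ∷ zs) (ℕ.s≤s F≤k) (ℕ.s≤s F≤m) =
  cong concat (map-cong-local (All.map (λ { {l , r} (l< , r<) →
    cong₂ (λ Ls Rs → concatMap (λ a → map (node a) Rs) Ls)
      (fuel-irrelevant k m l (ℕP.≤-trans (ℕ.s≤s⁻¹ l<) F≤k) (ℕP.≤-trans (ℕ.s≤s⁻¹ l<) F≤m))
      (fuel-irrelevant k m r (ℕP.≤-trans (ℕ.s≤s⁻¹ r<) F≤k) (ℕP.≤-trans (ℕ.s≤s⁻¹ r<) F≤m)) })
    (splits-shorter F)))

p-fuel : ∀ {n} (k : ℕ) (F : List (Subset n)) (T' : Tree n) → length F ℕ.≤ k →
  ∑ (bracketingsFuel k F) (λ T → weight T T') ≡ p F T'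
p-fuel k F T' F≤k =
  trans (cong (λ Ts → ∑ Ts (λ T → weight T T')) (fuel-irrelevant k (length F) F F≤k ℕP.≤-refl))
        (sym (p-weights F T'))

rooted : ∀ {n} → ℕ → List (Subset n) × List (Subset n) → List (Tree n)
rooted k lr = concatMap (λ a → map (node a) (bracketingsFuel k (proj₂ lr))) (bracketingsFuel k (proj₁ lr))

bracketings-by-root : ∀ {n} (k : ℕ) (x y : Subset n) (zs : List (Subset n)) →
  bracketingsFuel (suc k) (x ∷ y ∷ zs) ≡ concatMap (rooted k) (splits (x ∷ y ∷ zs))
bracketings-by-root k x y zs = cong concat (map-cong (λ { (l , r) → refl }) (splits (x ∷ y ∷ zs)))

-- A bracketing of F is a node over bracketings of
-- the two parts of a splitting of F, so this follows from weight-nodes.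
p-node : ∀ {n} (F : List (Subset n)) (U V : Tree n) → pOf (node U V) F ≡ ⟦ pOf U , pOf V ⟧ F
p-node []       U V = refl
p-node (x ∷ []) U V = refl
p-node F@(x ∷ y ∷ zs) U V = begin
  p F (node U V)
    ≡⟨ p-weights F (node U V) ⟩
  ∑ (bracketingsFuel (suc k) F) w
    ≡⟨ cong (λ Ts → ∑ Ts w) (bracketings-by-root k x y zs) ⟩
  ∑ (concatMap (rooted k) (splits F)) w
    ≡⟨ ∑-concatMap (splits F) (rooted k) w ⟩
  ∑ (splits F) (λ lr → ∑ (rooted k lr) w)
    ≡⟨ ∑-congAll (All.map (λ { {l , r} (l< , r<) → root-split l r l< r< }) (splits-shorter F)) ⟩
  ∑ (splits F) (λ lr → p (proj₁ lr) U * p (proj₂ lr) V - p (proj₁ lr) V * p (proj₂ lr) U)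
    ≡⟨ ∑-- (splits F) (λ lr → p (proj₁ lr) U * p (proj₂ lr) V) (λ lr → p (proj₁ lr) V * p (proj₂ lr) U) ⟩
  ⟦ pOf U , pOf V ⟧ F ∎
  where
  open ≡-Reasoning
  k = suc (length zs)
  w = λ T → weight T (node U V)
  root-split : ∀ l r → length l ℕ.< length F → length r ℕ.< length F →
    ∑ (rooted k (l , r)) w ≡ p l U * p r V - p l V * p r U
  root-split l r l< r< =
    trans (weight-nodes (bracketingsFuel k l) (bracketingsFuel k r) U V)
          (cong₂ _-_ (cong₂ _*_ (p-fuel k l U (ℕ.s≤s⁻¹ l<)) (p-fuel k r V (ℕ.s≤s⁻¹ r<)))
                     (cong₂ _*_ (p-fuel k l V (ℕ.s≤s⁻¹ l<)) (p-fuel k r U (ℕ.s≤s⁻¹ r<))))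

antisymmetry-at-root : ∀ {n} (A B : Tree n) (G : List (Subset n)) →
  ∑ (node A B ∷ node B A ∷ []) (p G) ≡ + 0
antisymmetry-at-root A B G = begin
  ∑ (node A B ∷ node B A ∷ []) (p G)   ≡⟨ ∑-pair (node A B) (node B A) (p G) ⟩
  p G (node A B) + p G (node B A)      ≡⟨ cong₂ _+_ (p-node G A B) (p-node G B A) ⟩
  ⟦ pOf A , pOf B ⟧ G + ⟦ pOf B , pOf A ⟧ G ≡⟨ ⟦⟧-antisym (pOf A) (pOf B) G ⟩
  + 0 ∎
  where open ≡-Reasoning

jacobi-at-root : ∀ {n} (A B D : Tree n) (G : List (Subset n)) →
  ∑ (node (node A B) D ∷ node (node B D) A ∷ node (node D A) B ∷ []) (p G) ≡ + 0
jacobi-at-root A B D G = begin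
  ∑ (node (node A B) D ∷ node (node B D) A ∷ node (node D A) B ∷ []) (p G)
    ≡⟨ ∑-triple (node (node A B) D) (node (node B D) A) (node (node D A) B) (p G) ⟩
  p G (node (node A B) D) + p G (node (node B D) A) + p G (node (node D A) B)
    ≡⟨ cong₂ _+_ (cong₂ _+_ (double-node A B D) (double-node B D A)) (double-node D A B) ⟩
  ⟦ ⟦ pOf A , pOf B ⟧ , pOf D ⟧ G + ⟦ ⟦ pOf B , pOf D ⟧ , pOf A ⟧ G + ⟦ ⟦ pOf D , pOf A ⟧ , pOf B ⟧ G
    ≡⟨ ⟦⟧-jacobi (pOf A) (pOf B) (pOf D) G ⟩
  + 0 ∎
  where
  open ≡-Reasoning
  double-node : ∀ X Y Z → p G (node (node X Y) Z) ≡ ⟦ ⟦ pOf X , pOf Y ⟧ , pOf Z ⟧ G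
  double-node X Y Z = trans (p-node G (node X Y) Z) (⟦⟧-cong (λ H → p-node H X Y) (λ _ → refl) G)

-- A formal sum of trees killed by every p_G is still killed after being
-- plugged into any context: at each node, p is bilinear in the branches.
killed-in-context : ∀ {n} (C : Ctx n) (Xs : List (Tree n)) →
  (∀ G → ∑ Xs (p G) ≡ + 0) → ∀ G → ∑ Xs (λ X → p G (plug C X)) ≡ + 0
killed-in-context hole      Xs killed = killed
killed-in-context (inL C B) Xs killed G =
  trans (∑-cong Xs (λ X → p-node G (plug C X) B))
        (⟦⟧-killsˡ Xs (λ X → pOf (plug C X)) (pOf B) (killed-in-context C Xs killed) G)
killed-in-context (inR A C) Xs killed G =
  trans (∑-cong Xs (λ X → p-node G A (plug C X)))
        (⟦⟧-killsʳ Xs (pOf A) (λ X → pOf (plug C X)) (killed-in-context C Xs killed) G)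

mainTheorem3 : (n : ℕ) → (F : List (Subset (suc n))) → IsComposition F →
    ((C : Ctx (suc n)) (A B : Tree (suc n)) →
      IsTreeOver (plug C (node A B)) →
      p F (plug C (node A B)) + p F (plug C (node B A)) ≡ + 0)
    × ((C : Ctx (suc n)) (A B D : Tree (suc n)) →
      IsTreeOver (plug C (node (node A B) D)) →
      p F (plug C (node (node A B) D)) + p F (plug C (node (node B D) A))
        + p F (plug C (node (node D A) B)) ≡ + 0)
mainTheorem3 n F _ =
    (λ C A B _ →
      trans (sym (∑-pair (node A B) (node B A) (λ X → p F (plug C X))))
            (killed-in-context C (node A B ∷ node B A ∷ []) (antisymmetry-at-root A B) F))
  , (λ C A B D _ →
      trans (sym (∑-triple (node (node A B) D) (node (node B D) A) (node (node D A) B)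
                           (λ X → p F (plug C X))))
            (killed-in-context C (node (node A B) D ∷ node (node B D) A ∷ node (node D A) B ∷ [])
                               (jacobi-at-root A B D) F))
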